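{- Let $G$ be a finite connected graph (multiple edges allowed, no loops) and let $\mathscr{B}$ be a strict bramble in $G$. Then the order of $\mathscr{B}$ equals the scramble order of $\mathscr{B}$.
   Context: For $A,B\subseteq V(G)$, $E(A,B)$ is the set of edges with one endpoint in $A$ and the other in $B$; $A^c=V(G)\setminus A$. A set $B\subseteq V(G)$ is connected if for every proper subset $A\subsetneq B$ the set $E(A,B\setminus A)$ is nonempty. A scramble is a finite set $\mathscr{S}$ of connected subsets of $V(G)$ (eggs). A bramble is a scramble such that $E\cup E'$ is connected for all $E,E'\in\mathscr{S}$; it is a strict bramble if every two of its elements have nonempty intersection. A hitting set is a set $C\subseteq V(G)$ meeting every egg. The order of a bramble is the minimum size of a hitting set. The scramble order $\|\mathscr{S}\|$ is the maximum integer $k$ such that (1) no $C\subseteq V(G)$ with $|C|<k$ is a hitting set for $\mathscr{S}$, and (2) for every $A\subseteq V(G)$ for which there are eggs $E,E'\in\mathscr{S}$ with $E\subseteq A$ and $E'\subseteq A^c$, one has $|E(A,A^c)|\geq k$. -}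

module Defs where

open import Data.Nat using (ℕ; zero; suc; _≤_; _<_)
open import Data.Fin using (Fin)
open import Data.Fin.Subset using (Subset; _∈_; _⊆_; _⊂_; _─_; _∪_; _∩_; ∁; ∣_∣; Nonempty; ⊤)
open import Data.Bool using (Bool; true; false; _∧_; _∨_; if_then_else_)
open import Data.List using (List; []; _∷_)
open import Data.List.Membership.Propositional using () renaming (_∈_ to _∈ₗ_)
open import Data.List.Relation.Unary.All using (All)
open import Data.Product using (_×_; _,_; proj₁; proj₂; ∃; Σ)
open import Data.Vec using (lookup)
open import Relation.Binary.PropositionalEquality using (_≡_; _≢_)

-- A finite loopless multigraph on vertex set Fin n: a list of edges
-- (pairs of distinct endpoints; repeated entries = parallel edges).
record Graph : Set where
  field
    n        : ℕ
    edges    : List (Fin n × Fin n)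
    loopless : All (λ e → proj₁ e ≢ proj₂ e) edges
open Graph public

V : Graph → Set
V G = Fin (n G)

VSet : Graph → Set
VSet G = Subset (n G)

crossesᵇ : ∀ {m} → Subset m → Subset m → Fin m × Fin m → Bool
crossesᵇ A B (u , v) = (lookup A u ∧ lookup B v) ∨ (lookup B u ∧ lookup A v)

countCross : ∀ {m} → Subset m → Subset m → List (Fin m × Fin m) → ℕ
countCross A B [] = 0
countCross A B (e ∷ es) =
  if crossesᵇ A B e then suc (countCross A B es) else countCross A B es

|E| : (G : Graph) → VSet G → VSet G → ℕ
|E| G A B = countCross A B (edges G)

E-nonempty : (G : Graph) → VSet G → VSet G → Set
E-nonempty G A B = ∃ λ e → e ∈ₗ edges G × crossesᵇ A B e ≡ true

Connected : (G : Graph) → VSet G → Set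
Connected G B =
  Nonempty B ×
  (∀ (A : VSet G) → Nonempty A → A ⊂ B → E-nonempty G A (B ─ A))

ConnectedGraph : Graph → Set
ConnectedGraph G = Connected G ⊤

Scramble : Graph → Set
Scramble G = List (VSet G)

IsScramble : (G : Graph) → Scramble G → Set
IsScramble G S = All (Connected G) S

IsBramble : (G : Graph) → Scramble G → Set
IsBramble G S =
  IsScramble G S × (∀ {E E′} → E ∈ₗ S → E′ ∈ₗ S → Connected G (E ∪ E′))

IsStrictBramble : (G : Graph) → Scramble G → Set
IsStrictBramble G S =
  IsBramble G S × (∀ {E E′} → E ∈ₗ S → E′ ∈ₗ S → Nonempty (E ∩ E′))

HittingSet : (G : Graph) → Scramble G → VSet G → Set
HittingSet G S C = ∀ {E} → E ∈ₗ S → Nonempty (C ∩ E)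

IsBrambleOrder : (G : Graph) → Scramble G → ℕ → Set
IsBrambleOrder G S k =
  (∃ λ C → HittingSet G S C × ∣ C ∣ ≡ k) ×
  (∀ C → HittingSet G S C → k ≤ ∣ C ∣)

-- conditions (1) and (2) in the definition of scramble order
ScrambleOrderCond : (G : Graph) → Scramble G → ℕ → Set
ScrambleOrderCond G S k =
  (∀ C → ∣ C ∣ < k → HittingSet G S C → Data.Empty.⊥) ×
  (∀ (A : VSet G) {E E′} → E ∈ₗ S → E′ ∈ₗ S → E ⊆ A → E′ ⊆ ∁ A →
     k ≤ |E| G A (∁ A))
  where import Data.Empty

IsScrambleOrder : (G : Graph) → Scramble G → ℕ → Set
IsScrambleOrder G S k =
  ScrambleOrderCond G S k × (∀ j → ScrambleOrderCond G S j → j ≤ k)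

-- For a strict bramble, condition (2) of the scramble order is vacuous: an
-- egg inside A and an egg inside Aᶜ would be disjoint.  What remains, "the
-- largest k such that no hitting set has fewer than k vertices", is the
-- minimum size of a hitting set; the minimum is attained because hitting
-- sets are decidable and there are finitely many vertex sets.
module Submission where

open import Defs
open import Data.Empty using (⊥; ⊥-elim)
open import Data.Fin.Subset using (Subset; Nonempty; _∩_; ∣_∣; _⊆_; ∁)
open import Data.Fin.Subset.Properties using (anySubset?; nonempty?; x∈p∩q⁻; x∈∁p⇒x∉p)
open import Data.List.Relation.Unary.All as All using (all?)
open import Data.List.Membership.Propositional using () renaming (_∈_ to _∈ₗ_)
open import Data.Nat using (ℕ; suc; _≤_; _<_; _≟_)
open import Data.Nat.Properties using (≮⇒≥; ≤-antisym; ≤-<-trans; <-irrefl; <⇒≱; m<1+n⇒m≤n; n<1+n)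
open import Data.Product using (_×_; _,_; proj₁; proj₂; ∃)
open import Function.Bundles using (_⇔_; mk⇔; Equivalence)
open import Function.Construct.Composition using (_⇔-∘_)
open import Relation.Nullary.Decidable using (yes; no; _×-dec_; map′)
open import Relation.Binary.PropositionalEquality using (_≡_; refl; subst)
open import Relation.Unary using (Decidable)

IsGreatest : (ℕ → Set) → ℕ → Set
IsGreatest Q k = Q k × (∀ j → Q j → j ≤ k)

IsGreatest-cong : ∀ {Q R : ℕ → Set} → (∀ j → Q j ⇔ R j) →
  ∀ k → IsGreatest Q k ⇔ IsGreatest R k
IsGreatest-cong Q⇔R k = mk⇔
  (λ (q , max) → Equivalence.to (Q⇔R k) q , λ j r → max j (Equivalence.from (Q⇔R j) r))
  (λ (r , max) → Equivalence.from (Q⇔R k) r , λ j q → max j (Equivalence.to (Q⇔R j) q))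

module MinimumSize {m : ℕ} (P : Subset m → Set) where

  IsMinimumSize : ℕ → Set
  IsMinimumSize k = (∃ λ C → P C × ∣ C ∣ ≡ k) × (∀ C → P C → k ≤ ∣ C ∣)

  NoneSmallerThan : ℕ → Set
  NoneSmallerThan k = ∀ C → ∣ C ∣ < k → P C → ⊥

  noneSmallerThan⇒≤ : ∀ {k} → NoneSmallerThan k → ∀ C → P C → k ≤ ∣ C ∣
  noneSmallerThan⇒≤ none C p = ≮⇒≥ (λ C<k → none C C<k p)

  ≤⇒noneSmallerThan : ∀ {k} → (∀ C → P C → k ≤ ∣ C ∣) → NoneSmallerThan k
  ≤⇒noneSmallerThan lower C C<k p = <-irrefl refl (≤-<-trans (lower C p) C<k)

  attained⇒greatest : ∀ {C k} → P C → ∣ C ∣ ≡ k → ∀ j → NoneSmallerThan j → j ≤ k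
  attained⇒greatest {C} p ∣C∣≡k j none = subst (j ≤_) ∣C∣≡k (noneSmallerThan⇒≤ none C p)

  -- Were no P-set of size exactly k, every P-set would have size > k, so
  -- suc k would also satisfy NoneSmallerThan, contradicting maximality of k.
  greatest⇒attained : Decidable P → ∀ {k} → IsGreatest NoneSmallerThan k →
    ∃ λ C → P C × ∣ C ∣ ≡ k
  greatest⇒attained P? {k} (none , max)
    with anySubset? (λ C → P? C ×-dec (∣ C ∣ ≟ k))
  ... | yes attained = attained
  ... | no unattained = ⊥-elim (<⇒≱ (n<1+n k) (max (suc k) noneSmallerThanSuc))
    where
    noneSmallerThanSuc : NoneSmallerThan (suc k)
    noneSmallerThanSuc C C<1+k p = unattained
      (C , p , ≤-antisym (m<1+n⇒m≤n C<1+k) (noneSmallerThan⇒≤ none C p))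

  minimumSize⇔greatestNoneSmallerThan : Decidable P →
    ∀ k → IsMinimumSize k ⇔ IsGreatest NoneSmallerThan k
  minimumSize⇔greatestNoneSmallerThan P? k = mk⇔
    (λ ((C , p , ∣C∣≡k) , lower) →
      ≤⇒noneSmallerThan lower , attained⇒greatest p ∣C∣≡k)
    (λ greatest@(none , _) →
      greatest⇒attained P? greatest , noneSmallerThan⇒≤ none)

intersecting⇒¬separated : ∀ {m} {A E E′ : Subset m} →
  Nonempty (E ∩ E′) → E ⊆ A → E′ ⊆ ∁ A → ⊥
intersecting⇒¬separated {E = E} {E′} (x , x∈E∩E′) E⊆A E′⊆∁A =
  x∈∁p⇒x∉p (E′⊆∁A x∈E′) (E⊆A x∈E)
  where
  x∈E = proj₁ (x∈p∩q⁻ E E′ x∈E∩E′)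
  x∈E′ = proj₂ (x∈p∩q⁻ E E′ x∈E∩E′)

hittingSet? : (G : Graph) (S : Scramble G) → Decidable (HittingSet G S)
hittingSet? G S C =
  map′ All.lookup All.tabulate (all? (λ E → nonempty? (C ∩ E)) S)

module _ (G : Graph) (S : Scramble G) where

  open MinimumSize (HittingSet G S)

  noneSmallerThan⇔scrambleOrderCond : IsStrictBramble G S →
    ∀ k → NoneSmallerThan k ⇔ ScrambleOrderCond G S k
  noneSmallerThan⇔scrambleOrderCond (_ , intersecting) k =
    mk⇔ (_, cutCondition) proj₁
    where
    cutCondition : ∀ (A : VSet G) {E E′} → E ∈ₗ S → E′ ∈ₗ S →
      E ⊆ A → E′ ⊆ ∁ A → k ≤ |E| G A (∁ A)
    cutCondition A E∈S E′∈S E⊆A E′⊆∁A =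
      ⊥-elim (intersecting⇒¬separated (intersecting E∈S E′∈S) E⊆A E′⊆∁A)

lemma3p5 : (G : Graph) → ConnectedGraph G → (S : Scramble G) →
    IsStrictBramble G S → (k : ℕ) → IsBrambleOrder G S k ⇔ IsScrambleOrder G S k
lemma3p5 G _ S strict k =
  IsGreatest-cong (noneSmallerThan⇔scrambleOrderCond G S strict) k
  ⇔-∘ minimumSize⇔greatestNoneSmallerThan (hittingSet? G S) k
  where open MinimumSize (HittingSet G S)
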